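{- Let $i,j,k,l,r$ be integers with $i+j=k+l$. Then $$u_ih_j-u_kh_l=q^r\left(u_{i-r}h_{j-r}-u_{k-r}h_{l-r}\right)$$ and $$u_iw_j-u_kw_l=q^r\left(u_{i-r}w_{j-r}-u_{k-r}w_{l-r}\right).$$
   Context: Let $a,b,p,q$ be complex numbers with $q\neq 0$. Sequences are indexed by $\mathbb{Z}$, extended to negative indices by solving the recurrence backwards. All satisfy $x_n=px_{n-1}-qx_{n-2}$, with initial values: $u_0=0,u_1=1$; Horadam sequence $w_0=a,w_1=b$; Horadam-Lucas sequence $h_0=2b-ap$, $h_1=bp-2aq$. (The paper names the indices $a,b,c,d$; they are renamed $i,j,k,l$ here to avoid a clash with the parameters $a,b$.) -}

module Defs where

open import Level using (Level)
open import Algebra.Bundles using (CommutativeRing)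
open import Data.Nat using (ℕ; zero; suc)
open import Data.Integer using (ℤ; +_; -[1+_])
open import Data.Product using (_×_; _,_; proj₁; proj₂)

-- Sequences over a commutative ring R with parameters p, q, where q is a unit
-- with (two-sided, since R is commutative) inverse qinv.
module Seqs {c ℓ : Level} (R : CommutativeRing c ℓ) (p q qinv : CommutativeRing.Carrier R) where
  open CommutativeRing R

  fwd : Carrier → Carrier → ℕ → Carrier × Carrier
  fwd x₀ x₁ zero = x₀ , x₁
  fwd x₀ x₁ (suc n) with fwd x₀ x₁ n
  ... | y , z = z , (p * z - q * y)

  -- backward pairs (x_{-n} , x_{-n+1}) for n ≥ 0, via x_{m-2} = (p x_{m-1} - x_m) q⁻¹
  bwd : Carrier → Carrier → ℕ → Carrier × Carrier
  bwd x₀ x₁ zero = x₀ , x₁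
  bwd x₀ x₁ (suc n) with bwd x₀ x₁ n
  ... | y , z = (p * y - z) * qinv , y

  seq : Carrier → Carrier → ℤ → Carrier
  seq x₀ x₁ (+ n) = proj₁ (fwd x₀ x₁ n)
  seq x₀ x₁ -[1+ n ] = proj₁ (bwd x₀ x₁ (suc n))

  pow : Carrier → ℕ → Carrier
  pow x zero = 1#
  pow x (suc n) = x * pow x n

  qpow : ℤ → Carrier
  qpow (+ n) = pow q n
  qpow -[1+ n ] = pow qinv (suc n)

  u : ℤ → Carrier
  u = seq 0# 1#

  w : Carrier → Carrier → ℤ → Carrier
  w a b = seq a b

  h : Carrier → Carrier → ℤ → Carrier
  h a b = seq ((b + b) - a * p) (b * p - (a + a) * q)

-- Put T(t) = u_{i+t} x_{j+t} - u_{k+t} x_{l+t} for a solution x of the recurrence; the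
-- claim is T(0) = q^r T(-r), so it suffices that T(t+1) = q T(t). By uniqueness of
-- solutions with prescribed x_0, x_1 (q being a unit, solutions extend uniquely to ℤ) one
-- gets the addition formula x_{m+n+1} = u_{m+1} x_{n+1} - q u_m x_n. Since a+b = c+d, the
-- expressions u_{a+1} x_{b+1} - q u_a x_b and u_{c+1} x_{d+1} - q u_c x_d both equal
-- x_{a+b+1}, and subtracting them gives T(t+1) - q T(t) = 0.
module Submission where

open import Defs
open import Level using (Level)
open import Algebra.Bundles using (CommutativeRing)
open import Algebra.Solver.Ring.AlmostCommutativeRing
  using (fromCommutativeRing; _-Raw-AlmostCommutative⟶_)
open import Data.Nat using (ℕ; zero; suc)
open import Data.Integer using (ℤ; +_; -[1+_]; _⊖_; 0ℤ; 1ℤ)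
import Data.Integer as ℤ
import Data.Integer.Properties as ℤ
open import Algebra.Properties.CommutativeSemigroup ℤ.+-commutativeSemigroup
  using (interchange; x∙yz≈y∙xz)
open import Data.Maybe using (map)
open import Data.Product using (_×_; _,_; proj₁)
open import Function using (_∘_)
open import Relation.Binary.Consequences using (dec⇒weaklyDec)
open import Relation.Binary.Definitions using (WeaklyDecidable)
open import Relation.Binary.PropositionalEquality as ≡ using (_≡_)

suc-+ : ∀ i j → ℤ.suc i ℤ.+ j ≡ ℤ.suc (i ℤ.+ j)
suc-+ = ℤ.+-assoc 1ℤ

+-suc : ∀ i t → i ℤ.+ ℤ.suc t ≡ ℤ.suc (i ℤ.+ t)
+-suc i = x∙yz≈y∙xz i 1ℤ

shifted-sums-equal : ∀ i j k l t → i ℤ.+ j ≡ k ℤ.+ l → (i ℤ.+ t) ℤ.+ (j ℤ.+ t) ≡ (k ℤ.+ t) ℤ.+ (l ℤ.+ t)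
shifted-sums-equal i j k l t i+j≡k+l = begin
  (i ℤ.+ t) ℤ.+ (j ℤ.+ t) ≡⟨ interchange i t j t ⟩
  (i ℤ.+ j) ℤ.+ (t ℤ.+ t) ≡⟨ ≡.cong (ℤ._+ (t ℤ.+ t)) i+j≡k+l ⟩
  (k ℤ.+ l) ℤ.+ (t ℤ.+ t) ≡⟨ interchange k t l t ⟨
  (k ℤ.+ t) ℤ.+ (l ℤ.+ t) ∎
  where open ≡.≡-Reasoning

-- Algebra.Solver.Ring needs a coefficient ring with decidable equality mapped into R;
-- ℤ maps into every commutative ring. With the TCOptimised multiplication 0 · 1# and
-- 1 · 1# are literally 0# and 1#, so the constants con (+ 0), con (+ 1) denote 0#, 1#.
module IntegerCoefficientSolver {c ℓ : Level} (R : CommutativeRing c ℓ) where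
  open CommutativeRing R
  open import Algebra.Properties.Semiring.Mult.TCOptimised semiring
    using (1+×; ×-homo-+; ×1-homo-*) renaming (_×_ to _·_)
  open import Algebra.Properties.Ring ring
    using (-‿involutive; -0#≈0#; -‿distribˡ-*; -‿distribʳ-*)
  open import Algebra.Properties.AbelianGroup +-abelianGroup using (xyx⁻¹≈y; ⁻¹-∙-comm)
  open import Relation.Binary.Reasoning.Setoid setoid

  fromℤ : ℤ → Carrier
  fromℤ (+ n)    = n · 1#
  fromℤ -[1+ n ] = - (suc n · 1#)

  fromℤ-homo-neg : ∀ i → fromℤ (ℤ.- i) ≈ - fromℤ i
  fromℤ-homo-neg -[1+ n ]  = sym (-‿involutive _)
  fromℤ-homo-neg (+ zero)  = sym -0#≈0#
  fromℤ-homo-neg (+ suc n) = refl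

  x+y-[x+z]≈y-z : ∀ x y z → (x + y) - (x + z) ≈ y - z
  x+y-[x+z]≈y-z x y z = begin
    (x + y) - (x + z)   ≈⟨ +-congˡ (⁻¹-∙-comm x z) ⟨
    (x + y) + (- x - z) ≈⟨ +-assoc _ _ _ ⟨
    x + y - x - z       ≈⟨ +-congʳ (xyx⁻¹≈y x y) ⟩
    y - z               ∎

  fromℤ-⊖ : ∀ m n → fromℤ (m ⊖ n) ≈ m · 1# - n · 1#
  fromℤ-⊖ m       zero    = sym (trans (+-congˡ -0#≈0#) (+-identityʳ _))
  fromℤ-⊖ zero    (suc n) = sym (+-identityˡ _)
  fromℤ-⊖ (suc m) (suc n) = begin
    fromℤ (suc m ⊖ suc n)          ≡⟨ ≡.cong fromℤ (ℤ.[1+m]⊖[1+n]≡m⊖n m n) ⟩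
    fromℤ (m ⊖ n)                  ≈⟨ fromℤ-⊖ m n ⟩
    m · 1# - n · 1#                ≈⟨ x+y-[x+z]≈y-z 1# _ _ ⟨
    (1# + m · 1#) - (1# + n · 1#)  ≈⟨ +-cong (1+× m 1#) (-‿cong (1+× n 1#)) ⟨
    suc m · 1# - suc n · 1#        ∎

  fromℤ-homo-+ : ∀ i j → fromℤ (i ℤ.+ j) ≈ fromℤ i + fromℤ j
  fromℤ-homo-+ (+ m)    (+ n)    = ×-homo-+ 1# m n
  fromℤ-homo-+ (+ m)    -[1+ n ] = fromℤ-⊖ m (suc n)
  fromℤ-homo-+ -[1+ m ] (+ n)    = trans (fromℤ-⊖ n (suc m)) (+-comm _ _)
  fromℤ-homo-+ -[1+ m ] -[1+ n ] = begin
    fromℤ (-[1+ m ] ℤ.+ -[1+ n ])     ≡⟨ ≡.cong fromℤ (ℤ.neg-distrib-+ (+ suc m) (+ suc n)) ⟨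
    fromℤ (ℤ.- (+ suc m ℤ.+ + suc n)) ≈⟨ fromℤ-homo-neg (+ suc m ℤ.+ + suc n) ⟩
    - fromℤ (+ suc m ℤ.+ + suc n)     ≈⟨ -‿cong (×-homo-+ 1# (suc m) (suc n)) ⟩
    - (suc m · 1# + suc n · 1#)       ≈⟨ ⁻¹-∙-comm _ _ ⟨
    fromℤ -[1+ m ] + fromℤ -[1+ n ]   ∎

  fromℤ-homo-+* : ∀ m j → fromℤ (+ m ℤ.* j) ≈ fromℤ (+ m) * fromℤ j
  fromℤ-homo-+* m (+ n)    = trans (reflexive (≡.cong fromℤ (≡.sym (ℤ.pos-* m n)))) (×1-homo-* m n)
  fromℤ-homo-+* m -[1+ n ] = begin
    fromℤ (+ m ℤ.* -[1+ n ])          ≡⟨ ≡.cong fromℤ (ℤ.neg-distribʳ-* (+ m) (+ suc n)) ⟨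
    fromℤ (ℤ.- (+ m ℤ.* + suc n))     ≈⟨ fromℤ-homo-neg (+ m ℤ.* + suc n) ⟩
    - fromℤ (+ m ℤ.* + suc n)         ≈⟨ -‿cong (fromℤ-homo-+* m (+ suc n)) ⟩
    - (fromℤ (+ m) * fromℤ (+ suc n)) ≈⟨ -‿distribʳ-* _ _ ⟩
    fromℤ (+ m) * fromℤ -[1+ n ]      ∎

  fromℤ-homo-* : ∀ i j → fromℤ (i ℤ.* j) ≈ fromℤ i * fromℤ j
  fromℤ-homo-* (+ m)    j = fromℤ-homo-+* m j
  fromℤ-homo-* -[1+ m ] j = begin
    fromℤ (-[1+ m ] ℤ.* j)          ≡⟨ ≡.cong fromℤ (ℤ.neg-distribˡ-* (+ suc m) j) ⟨
    fromℤ (ℤ.- (+ suc m ℤ.* j))     ≈⟨ fromℤ-homo-neg (+ suc m ℤ.* j) ⟩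
    - fromℤ (+ suc m ℤ.* j)         ≈⟨ -‿cong (fromℤ-homo-+* (suc m) j) ⟩
    - (fromℤ (+ suc m) * fromℤ j)   ≈⟨ -‿distribˡ-* _ _ ⟩
    fromℤ -[1+ m ] * fromℤ j        ∎

  fromℤ-homomorphism : ℤ.+-*-rawRing -Raw-AlmostCommutative⟶ fromCommutativeRing R
  fromℤ-homomorphism = record
    { ⟦_⟧    = fromℤ
    ; +-homo = fromℤ-homo-+
    ; *-homo = fromℤ-homo-*
    ; -‿homo = fromℤ-homo-neg
    ; 0-homo = refl
    ; 1-homo = refl
    }

  fromℤ-≟ : WeaklyDecidable (λ i j → fromℤ i ≈ fromℤ j)
  fromℤ-≟ i j = map (λ { ≡.refl → refl }) (dec⇒weaklyDec ℤ._≟_ i j)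

  open import Algebra.Solver.Ring ℤ.+-*-rawRing (fromCommutativeRing R) fromℤ-homomorphism fromℤ-≟
    public using (solve; _:=_; _:+_; _:*_; _:-_; con)

module HoradamRecurrence {c ℓ : Level} (R : CommutativeRing c ℓ)
  (p q qinv : CommutativeRing.Carrier R)
  (q*qinv≈1 : CommutativeRing._≈_ R (CommutativeRing._*_ R q qinv) (CommutativeRing.1# R)) where
  open CommutativeRing R
  open Seqs R p q qinv
  open IntegerCoefficientSolver R
  open import Relation.Binary.Reasoning.Setoid setoid

  Recurrent : (ℤ → Carrier) → Set ℓ
  Recurrent x = ∀ n → x (ℤ.suc (ℤ.suc n)) ≈ p * x (ℤ.suc n) - q * x n

  q*[x*qinv]≈x : ∀ x → q * (x * qinv) ≈ x
  q*[x*qinv]≈x x = begin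
    q * (x * qinv)   ≈⟨ solve 3 (λ q x i → q :* (x :* i) := (q :* i) :* x) refl q x qinv ⟩
    (q * qinv) * x   ≈⟨ *-congʳ q*qinv≈1 ⟩
    1# * x           ≈⟨ *-identityˡ x ⟩
    x                ∎

  qinv*q*x≈x : ∀ x → qinv * (q * x) ≈ x
  qinv*q*x≈x x =
    trans (solve 3 (λ i q x → i :* (q :* x) := q :* (x :* i)) refl qinv q x) (q*[x*qinv]≈x x)

  q*-injective : ∀ {x y} → q * x ≈ q * y → x ≈ y
  q*-injective {x} {y} qx≈qy = begin
    x                ≈⟨ qinv*q*x≈x x ⟨
    qinv * (q * x)   ≈⟨ *-congˡ qx≈qy ⟩
    qinv * (q * y)   ≈⟨ qinv*q*x≈x y ⟩
    y                ∎

  x≈y-z⇒z≈y-x : ∀ {x y z} → x ≈ y - z → z ≈ y - x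
  x≈y-z⇒z≈y-x {x} {y} {z} x≈y-z = begin
    z                ≈⟨ solve 2 (λ y z → z := y :- (y :- z)) refl y z ⟩
    y - (y - z)      ≈⟨ +-congˡ (-‿cong x≈y-z) ⟨
    y - x            ∎

  bwd-step-recurrent : ∀ x₀ x₁ → x₁ ≈ p * x₀ - q * ((p * x₀ - x₁) * qinv)
  bwd-step-recurrent x₀ x₁ = x≈y-z⇒z≈y-x (q*[x*qinv]≈x (p * x₀ - x₁))

  seq-recurrent : ∀ x₀ x₁ → Recurrent (seq x₀ x₁)
  -- Every case holds by unfolding seq; the negative indices are split so that ℤ.suc reduces.
  seq-recurrent x₀ x₁ (+ n)                = refl
  seq-recurrent x₀ x₁ -[1+ zero ]          = bwd-step-recurrent _ _
  seq-recurrent x₀ x₁ -[1+ suc zero ]      = bwd-step-recurrent _ _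
  seq-recurrent x₀ x₁ -[1+ suc (suc n) ]   = bwd-step-recurrent _ _

  recurrent-backward : ∀ {x} → Recurrent x → ∀ n → q * x n ≈ p * x (ℤ.suc n) - x (ℤ.suc (ℤ.suc n))
  recurrent-backward x-rec n = x≈y-z⇒z≈y-x (x-rec n)

  module _ {y z : ℤ → Carrier} (y-rec : Recurrent y) (z-rec : Recurrent z) where

    agree-forward : ∀ n → y n ≈ z n → y (ℤ.suc n) ≈ z (ℤ.suc n) →
                    y (ℤ.suc (ℤ.suc n)) ≈ z (ℤ.suc (ℤ.suc n))
    agree-forward n y₀≈z₀ y₁≈z₁ = begin
      y (ℤ.suc (ℤ.suc n))                ≈⟨ y-rec n ⟩
      p * y (ℤ.suc n) - q * y n          ≈⟨ +-cong (*-congˡ y₁≈z₁) (-‿cong (*-congˡ y₀≈z₀)) ⟩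
      p * z (ℤ.suc n) - q * z n          ≈⟨ z-rec n ⟨
      z (ℤ.suc (ℤ.suc n))                ∎

    agree-backward : ∀ n → y (ℤ.suc n) ≈ z (ℤ.suc n) → y (ℤ.suc (ℤ.suc n)) ≈ z (ℤ.suc (ℤ.suc n)) →
                     y n ≈ z n
    agree-backward n y₁≈z₁ y₂≈z₂ = q*-injective (begin
      q * y n                            ≈⟨ recurrent-backward y-rec n ⟩
      p * y (ℤ.suc n) - y (ℤ.suc (ℤ.suc n)) ≈⟨ +-cong (*-congˡ y₁≈z₁) (-‿cong y₂≈z₂) ⟩
      p * z (ℤ.suc n) - z (ℤ.suc (ℤ.suc n)) ≈⟨ recurrent-backward z-rec n ⟨
      q * z n                            ∎)

    recurrent-unique : y 0ℤ ≈ z 0ℤ → y 1ℤ ≈ z 1ℤ → ∀ n → y n ≈ z n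
    recurrent-unique y₀≈z₀ y₁≈z₁ (+ n)    = proj₁ (upward n)
      where
      upward : ∀ n → y (+ n) ≈ z (+ n) × y (+ suc n) ≈ z (+ suc n)
      upward zero    = y₀≈z₀ , y₁≈z₁
      upward (suc n) = let (yₙ≈zₙ , yₙ₊₁≈zₙ₊₁) = upward n in
                       yₙ₊₁≈zₙ₊₁ , agree-forward (+ n) yₙ≈zₙ yₙ₊₁≈zₙ₊₁
    recurrent-unique y₀≈z₀ y₁≈z₁ -[1+ n ] = proj₁ (downward n)
      where
      downward : ∀ n → y -[1+ n ] ≈ z -[1+ n ] × y (ℤ.suc -[1+ n ]) ≈ z (ℤ.suc -[1+ n ])
      downward zero    = agree-backward -[1+ 0 ] y₀≈z₀ y₁≈z₁ , y₀≈z₀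
      downward (suc n) = let (y₋ₙ₋₁≈z₋ₙ₋₁ , y₋ₙ≈z₋ₙ) = downward n in
                         agree-backward -[1+ suc n ] y₋ₙ₋₁≈z₋ₙ₋₁ y₋ₙ≈z₋ₙ , y₋ₙ₋₁≈z₋ₙ₋₁

    recurrent-linear : ∀ a b → Recurrent (λ n → y n * a - z n * b)
    recurrent-linear a b n = begin
      y (ℤ.suc (ℤ.suc n)) * a - z (ℤ.suc (ℤ.suc n)) * b
        ≈⟨ +-cong (*-congʳ (y-rec n)) (-‿cong (*-congʳ (z-rec n))) ⟩
      (p * y (ℤ.suc n) - q * y n) * a - (p * z (ℤ.suc n) - q * z n) * b
        ≈⟨ solve 8 (λ p q y₀ y₁ z₀ z₁ a b →
             (p :* y₁ :- q :* y₀) :* a :- (p :* z₁ :- q :* z₀) :* b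
             := p :* (y₁ :* a :- z₁ :* b) :- q :* (y₀ :* a :- z₀ :* b))
           refl p q (y n) (y (ℤ.suc n)) (z n) (z (ℤ.suc n)) a b ⟩
      p * (y (ℤ.suc n) * a - z (ℤ.suc n) * b) - q * (y n * a - z n * b) ∎

  recurrent-shift : ∀ {x} → Recurrent x → ∀ k → Recurrent (λ n → x (n ℤ.+ k))
  recurrent-shift {x} x-rec k n = begin
    x (ℤ.suc (ℤ.suc n) ℤ.+ k)               ≡⟨ ≡.cong x (suc-+ (ℤ.suc n) k) ⟩
    x (ℤ.suc (ℤ.suc n ℤ.+ k))               ≡⟨ ≡.cong (x ∘ ℤ.suc) (suc-+ n k) ⟩
    x (ℤ.suc (ℤ.suc (n ℤ.+ k)))             ≈⟨ x-rec (n ℤ.+ k) ⟩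
    p * x (ℤ.suc (n ℤ.+ k)) - q * x (n ℤ.+ k) ≡⟨ ≡.cong (λ m → p * x m - q * x (n ℤ.+ k)) (suc-+ n k) ⟨
    p * x (ℤ.suc n ℤ.+ k) - q * x (n ℤ.+ k) ∎

  u-recurrent : Recurrent u
  u-recurrent = seq-recurrent 0# 1#

  recurrent-addition : ∀ {x} → Recurrent x → ∀ m n →
                       x (ℤ.suc (m ℤ.+ n)) ≈ u (ℤ.suc m) * x (ℤ.suc n) - u m * (q * x n)
  recurrent-addition {x} x-rec m n =
    recurrent-unique (recurrent-shift (x-rec ∘ ℤ.suc) n)
                     (recurrent-linear (u-recurrent ∘ ℤ.suc) u-recurrent (x (ℤ.suc n)) (q * x n))
                     at-0 at-1 m
    where
    at-0 : x (ℤ.suc (0ℤ ℤ.+ n)) ≈ 1# * x (ℤ.suc n) - 0# * (q * x n)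
    at-0 = begin
      x (ℤ.suc (0ℤ ℤ.+ n))            ≡⟨ ≡.cong (x ∘ ℤ.suc) (ℤ.+-identityˡ n) ⟩
      x (ℤ.suc n)                     ≈⟨ solve 2 (λ x₁ y → x₁ := con (+ 1) :* x₁ :- con (+ 0) :* y)
                                          refl (x (ℤ.suc n)) (q * x n) ⟩
      1# * x (ℤ.suc n) - 0# * (q * x n) ∎
    at-1 : x (ℤ.suc (1ℤ ℤ.+ n)) ≈ (p * 1# - q * 0#) * x (ℤ.suc n) - 1# * (q * x n)
    at-1 = begin
      x (ℤ.suc (ℤ.suc n))             ≈⟨ x-rec n ⟩
      p * x (ℤ.suc n) - q * x n       ≈⟨ solve 4 (λ p q x₀ x₁ → p :* x₁ :- q :* x₀
                                            := (p :* con (+ 1) :- q :* con (+ 0)) :* x₁ :- con (+ 1) :* (q :* x₀))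
                                          refl p q (x n) (x (ℤ.suc n)) ⟩
      (p * 1# - q * 0#) * x (ℤ.suc n) - 1# * (q * x n) ∎

  Δ : (ℤ → Carrier) → ℤ → ℤ → ℤ → ℤ → Carrier
  Δ x i j k l = u i * x j - u k * x l

  Δ-cong : ∀ x {i i′ j j′ k k′ l l′} → i ≡ i′ → j ≡ j′ → k ≡ k′ → l ≡ l′ → Δ x i j k l ≡ Δ x i′ j′ k′ l′
  Δ-cong x ≡.refl ≡.refl ≡.refl ≡.refl = ≡.refl

  Δ-suc : ∀ {x} → Recurrent x → ∀ i j k l → i ℤ.+ j ≡ k ℤ.+ l →
          Δ x (ℤ.suc i) (ℤ.suc j) (ℤ.suc k) (ℤ.suc l) ≈ q * Δ x i j k l
  Δ-suc {x} x-rec i j k l i+j≡k+l = begin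
    A - C                               ≈⟨ solve 4 (λ A B C D → A :- C := (A :- B) :- (C :- D) :+ (B :- D))
                                             refl A B C D ⟩
    (A - B) - (C - D) + (B - D)         ≈⟨ +-congʳ (+-congʳ A-B≈C-D) ⟩
    (C - D) - (C - D) + (B - D)         ≈⟨ solve 6 (λ E q uᵢ xⱼ uₖ xₗ →
                                               E :- E :+ (uᵢ :* (q :* xⱼ) :- uₖ :* (q :* xₗ))
                                               := q :* (uᵢ :* xⱼ :- uₖ :* xₗ))
                                             refl (C - D) q (u i) (x j) (u k) (x l) ⟩
    q * Δ x i j k l                     ∎
    where
    A = u (ℤ.suc i) * x (ℤ.suc j)
    B = u i * (q * x j)
    C = u (ℤ.suc k) * x (ℤ.suc l)
    D = u k * (q * x l)
    A-B≈C-D : A - B ≈ C - D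
    A-B≈C-D = begin
      A - B                     ≈⟨ recurrent-addition x-rec i j ⟨
      x (ℤ.suc (i ℤ.+ j))       ≡⟨ ≡.cong (x ∘ ℤ.suc) i+j≡k+l ⟩
      x (ℤ.suc (k ℤ.+ l))       ≈⟨ recurrent-addition x-rec k l ⟩
      C - D                     ∎

  geometric : ∀ c (S : ℕ → Carrier) → (∀ n → S n ≈ c * S (suc n)) → ∀ n → S 0 ≈ pow c n * S n
  geometric c S S-step zero    = sym (*-identityˡ (S 0))
  geometric c S S-step (suc n) = begin
    S 0                        ≈⟨ geometric c S S-step n ⟩
    pow c n * S n              ≈⟨ *-congˡ (S-step n) ⟩
    pow c n * (c * S (suc n))  ≈⟨ solve 3 (λ cⁿ c s → cⁿ :* (c :* s) := c :* cⁿ :* s)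
                                        refl (pow c n) c (S (suc n)) ⟩
    c * pow c n * S (suc n)    ∎

  qpow-geometric : ∀ (T : ℤ → Carrier) → (∀ t → T (ℤ.suc t) ≈ q * T t) → ∀ r → T 0ℤ ≈ qpow r * T (ℤ.- r)
  qpow-geometric T T-suc (+ n)    = geometric q (λ n → T (ℤ.- + n)) step n
    where
    step : ∀ n → T (ℤ.- + n) ≈ q * T -[1+ n ]
    step n = trans (reflexive (≡.cong T (≡.sym (ℤ.1-[1+n]≡-n n)))) (T-suc -[1+ n ])
  qpow-geometric T T-suc -[1+ n ] = geometric qinv (λ n → T (+ n)) step (suc n)
    where
    step : ∀ n → T (+ n) ≈ qinv * T (+ suc n)
    step n = sym (trans (*-congˡ (T-suc (+ n))) (qinv*q*x≈x (T (+ n))))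

  Δ-qpow : ∀ {x} → Recurrent x → ∀ i j k l r → i ℤ.+ j ≡ k ℤ.+ l →
           Δ x i j k l ≈ qpow r * Δ x (i ℤ.- r) (j ℤ.- r) (k ℤ.- r) (l ℤ.- r)
  Δ-qpow {x} x-rec i j k l r i+j≡k+l = begin
    Δ x i j k l     ≡⟨ Δ-cong x (ℤ.+-identityʳ i) (ℤ.+-identityʳ j) (ℤ.+-identityʳ k) (ℤ.+-identityʳ l) ⟨
    T 0ℤ            ≈⟨ qpow-geometric T T-suc r ⟩
    qpow r * T (ℤ.- r) ∎
    where
    T : ℤ → Carrier
    T t = Δ x (i ℤ.+ t) (j ℤ.+ t) (k ℤ.+ t) (l ℤ.+ t)
    T-suc : ∀ t → T (ℤ.suc t) ≈ q * T t
    T-suc t = begin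
      T (ℤ.suc t)  ≡⟨ Δ-cong x (+-suc i t) (+-suc j t) (+-suc k t) (+-suc l t) ⟩
      Δ x (ℤ.suc (i ℤ.+ t)) (ℤ.suc (j ℤ.+ t)) (ℤ.suc (k ℤ.+ t)) (ℤ.suc (l ℤ.+ t))
        ≈⟨ Δ-suc x-rec (i ℤ.+ t) (j ℤ.+ t) (k ℤ.+ t) (l ℤ.+ t) (shifted-sums-equal i j k l t i+j≡k+l) ⟩
      q * T t ∎

mainTheorem15 : {c ℓ : Level} (R : CommutativeRing c ℓ)
    → let open CommutativeRing R in
      (a b p q qinv : Carrier) → q * qinv ≈ 1#
    → let open Seqs R p q qinv in
      (i j k l r : ℤ) → i ℤ.+ j ≡ k ℤ.+ l
    → ((u i * h a b j) - (u k * h a b l)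
         ≈ qpow r * ((u (i ℤ.- r) * h a b (j ℤ.- r)) - (u (k ℤ.- r) * h a b (l ℤ.- r))))
      × ((u i * w a b j) - (u k * w a b l)
         ≈ qpow r * ((u (i ℤ.- r) * w a b (j ℤ.- r)) - (u (k ℤ.- r) * w a b (l ℤ.- r))))
mainTheorem15 R a b p q qinv q*qinv≈1 i j k l r i+j≡k+l =
  Δ-qpow (seq-recurrent _ _) i j k l r i+j≡k+l , Δ-qpow (seq-recurrent a b) i j k l r i+j≡k+l
  where open HoradamRecurrence R p q qinv q*qinv≈1
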